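{- Let $p$ be an odd prime, $a$ an integer with $p\nmid a$, $b=b_0p^{b_1}$, $c=c_0p^{c_1}$ with $0\le b_1\le c_1$, $\gcd(b_0,p)=\gcd(c_0,p)=1$, and let $m=m_0p^{m_1}$ be a nonzero integer with $\gcd(m_0,p)=1$. Let $k>m_1$ be an integer and for $0\le\tau\le k-1$ set $$s_{k,\tau}=\sum_{t_0\in(\mathbb Z/p^{k-\tau}\mathbb Z)^*}e\!\left(\frac{ -m_0t_0p^{m_1+\tau}}{p^k}\right)G(at_0p^\tau;p^k)\,G(b_0t_0p^{b_1+\tau};p^k)\,G(c_0t_0p^{c_1+\tau};p^k).$$ If $k-\min(m_1,b_1)\le\tau\le k-1$, then $$s_{k,\tau}=\begin{cases}p^{3k+(k-\tau)/2}\left(1-\frac1p\right), & k-\tau\text{ even},\\ 0, & k-\tau\text{ odd}.\end{cases}$$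
   Context: $e(w)=e^{2\pi i w}$; $G(a;q)=\sum_{j=0}^{q-1}e\!\left(\frac{aj^2}{q}\right)$. -}

module Defs where

open import Level using (Level)
open import Data.Nat using (ℕ; zero; suc; NonZero)
import Data.Nat as ℕ
open import Data.Integer using (ℤ; _%ℕ_)
open import Data.Nat.Coprimality using (coprime?)
open import Relation.Nullary using (does)
open import Data.Bool using (if_then_else_)
open import Algebra.Bundles using (CommutativeRing)

-- n mod N as a natural number (N = 0 gives 0; never used with N = 0)
modN : ℤ → ℕ → ℕ
modN z zero    = 0
modN z (suc n) = z %ℕ suc n

module Sums {c ℓ : Level} (R : CommutativeRing c ℓ) (ζ : CommutativeRing.Carrier R) where
  open CommutativeRing R

  pow : Carrier → ℕ → Carrier
  pow x zero    = 1#
  pow x (suc n) = x * pow x n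

  natR : ℕ → Carrier
  natR zero    = 0#
  natR (suc n) = 1# + natR n

  sumTo : ℕ → (ℕ → Carrier) → Carrier
  sumTo zero    f = 0#
  sumTo (suc n) f = sumTo n f + f n

  -- ζ is a root of the N-th cyclotomic polynomial for N = p^k (k ≥ 1):
  -- Φ_{p^k}(x) = Σ_{i=0}^{p-1} x^{i p^{k-1}}
  IsRootΦ : ℕ → ℕ → Set ℓ
  IsRootΦ p k = sumTo p (λ i → pow ζ (i ℕ.* p ℕ.^ (k ℕ.∸ 1))) ≈ 0#

  -- e(n / N) := ζ^(n mod N), where ζ plays the role of e(1/N), N = p^k
  e : ℕ → ℤ → Carrier
  e N n = pow ζ (modN n N)

  G : ℤ → ℕ → Carrier
  G A N = sumTo N (λ j → e N (A Data.Integer.* (Data.Integer.+ (j ℕ.* j))))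

  -- s_{k,τ}: sum over t0 ∈ [0, p^{k-τ}) coprime to p (i.e. (ℤ/p^{k-τ}ℤ)^*)
  s : (p : ℕ) (a b₀ c₀ m₀ : ℤ) (b₁ c₁ m₁ k τ : ℕ) → Carrier
  s p a b₀ c₀ m₀ b₁ c₁ m₁ k τ =
    sumTo (p ℕ.^ (k ℕ.∸ τ)) λ t₀ →
      if does (coprime? t₀ p)
      then (let t = Data.Integer.+ t₀
                P : ℕ → ℤ
                P n = Data.Integer.+ (p ℕ.^ n)
                N = p ℕ.^ k
            in e N (Data.Integer.- (m₀ Data.Integer.* t Data.Integer.* P (m₁ ℕ.+ τ)))
               * G (a Data.Integer.* t Data.Integer.* P τ) N
               * G (b₀ Data.Integer.* t Data.Integer.* P (b₁ ℕ.+ τ)) N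
               * G (c₀ Data.Integer.* t Data.Integer.* P (c₁ ℕ.+ τ)) N)
      else 0#

-- Since τ ≥ k - min(m₁, b₁) and b₁ ≤ c₁, the exponents m₁ + τ, b₁ + τ, c₁ + τ are at least k: the
-- exponential factor of s_{k,τ} is 1 and the Gauss sums with b₀ and c₀ both equal p^k.  With j = k - τ this leaves p^{2k} Σ_{t < p^j, p ∤ t} G(a t p^τ; p^k),
-- the sum over all t < p^j minus the sum over t = p q with q < p^{j-1}.
-- For v + m = k, orthogonality of t ↦ ζ^{n p^v t} on ℤ/p^m and p^m ∣ a x² ⟺ p^⌈m/2⌉ ∣ x (as p ∤ a) give
--   Σ_{x < p^k} Σ_{t < p^m} ζ^{a x² p^v t} = p^m · #{x < p^k : p^⌈m/2⌉ ∣ x} = p^{k + ⌊m/2⌋},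
-- hence s_{k,τ} = p^{3k + ⌊j/2⌋} - p^{3k + ⌊(j-1)/2⌋}: the claimed value for j even, 0 for j odd.
-- Of ζ only Φ_{p^k}(ζ) = 0 is known; it yields ζ^{p^k} = 1 and, by permuting the residues mod p,
-- Σ_{i<p} ζ^{u i p^{k-1}} = 0 for p ∤ u.

module Submission where

open import Defs
open import Level using (Level)
open import Data.Nat using (ℕ; zero; suc; _+_; _*_; _∸_; _^_; _≤_; _<_; _⊓_; ⌊_/2⌋; ⌈_/2⌉; NonZero; s≤s; nonTrivial⇒n>1)
import Data.Nat.Properties as ℕ
open import Data.Nat.DivMod using (_%_; _/_; m≡m%n+[m/n]*n; m%n<n; %-distribˡ-*; m%n%n≡m%n; [m+kn]%n≡m%n; m<n⇒m%n≡m)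
open import Data.Nat.Primality using (Prime; euclidsLemma; prime⇒irreducible; prime⇒nonZero; prime⇒nonTrivial)
open import Data.Nat.Coprimality using (Coprime; coprime?; coprime-Bézout)
open import Data.Nat.GCD using (module Bézout)
open import Data.Nat.Tactic.RingSolver using (solve-∀)
open import Data.Integer.Tactic.RingSolver using () renaming (solve-∀ to ℤsolve-∀)
open import Data.Integer using (ℤ; ∣_∣; +_)
import Data.Integer as ℤ
import Data.Integer.Properties as ℤ
open import Data.Integer.DivMod using (a≡a%ℕn+[a/ℕn]*n)
import Data.Product
open import Data.Product using (∃; _,_)
open import Data.Sum using (inj₁; inj₂)
open import Data.Empty using (⊥-elim)
open import Data.Bool using (if_then_else_)
open import Relation.Nullary using (¬_; Dec; yes; no; does; contradiction)
open import Relation.Binary.PropositionalEquality as ≡ using (_≡_; _≢_; cong; cong₂; subst; subst₂; module ≡-Reasoning)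
open import Algebra.Bundles using (CommutativeRing)

⌊2*n/2⌋≡n : ∀ n → ⌊ 2 * n /2⌋ ≡ n
⌊2*n/2⌋≡n n = ≡.trans (cong ⌊_/2⌋ (cong (λ m → n + m) (ℕ.+-identityʳ n))) (≡.sym (ℕ.n≡⌊n+n/2⌋ n))

⌈2*n/2⌉≡n : ∀ n → ⌈ 2 * n /2⌉ ≡ n
⌈2*n/2⌉≡n n = ≡.trans (cong ⌈_/2⌉ (cong (λ m → n + m) (ℕ.+-identityʳ n))) (≡.sym (ℕ.n≡⌈n+n/2⌉ n))

k∸⌈m/2⌉+m≡k+⌊m/2⌋ : ∀ {m k} → m ≤ k → k ∸ ⌈ m /2⌉ + m ≡ k + ⌊ m /2⌋
k∸⌈m/2⌉+m≡k+⌊m/2⌋ {m} {k} m≤k = begin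
  k ∸ ⌈ m /2⌉ + m                    ≡⟨ cong (λ n → k ∸ ⌈ m /2⌉ + n) (ℕ.⌊n/2⌋+⌈n/2⌉≡n m) ⟨
  k ∸ ⌈ m /2⌉ + (⌊ m /2⌋ + ⌈ m /2⌉)  ≡⟨ cong (λ n → k ∸ ⌈ m /2⌉ + n) (ℕ.+-comm ⌊ m /2⌋ ⌈ m /2⌉) ⟩
  k ∸ ⌈ m /2⌉ + (⌈ m /2⌉ + ⌊ m /2⌋)  ≡⟨ ℕ.+-assoc (k ∸ ⌈ m /2⌉) ⌈ m /2⌉ ⌊ m /2⌋ ⟨
  k ∸ ⌈ m /2⌉ + ⌈ m /2⌉ + ⌊ m /2⌋    ≡⟨ cong (_+ ⌊ m /2⌋) (ℕ.m∸n+n≡m (ℕ.≤-trans (ℕ.⌈n/2⌉≤n m) m≤k)) ⟩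
  k + ⌊ m /2⌋                        ∎
  where open ≡-Reasoning

module PrimeDivisibility {p : ℕ} (p-prime : Prime p) where
  open import Data.Nat.Divisibility
  open ≡ using (refl; sym; trans)
  open ≡-Reasoning

  instance
    p-nonZero : NonZero p
    p-nonZero = prime⇒nonZero p-prime

  1<p : 1 < p
  1<p = nonTrivial⇒n>1 p {{prime⇒nonTrivial p-prime}}

  ¬∣⇒coprime : ∀ {u} → ¬ p ∣ u → Coprime u p
  ¬∣⇒coprime p∤u (d∣u , d∣p) with prime⇒irreducible p-prime d∣p
  ... | inj₁ d≡1 = d≡1
  ... | inj₂ refl = contradiction d∣u p∤u

  coprime⇒¬∣ : ∀ {u} → Coprime u p → ¬ p ∣ u
  coprime⇒¬∣ u⊥p p∣u = ℕ.<⇒≢ 1<p (sym (u⊥p (p∣u , ∣-refl)))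

  mod-inverse : ∀ {u} → ¬ p ∣ u → ∃ λ v → (u * v) % p ≡ 1
  mod-inverse {u} p∤u with coprime-Bézout (¬∣⇒coprime p∤u)
  ... | Bézout.+- x y 1+yp≡xu = x , (begin
    (u * x) % p     ≡⟨ cong (_% p) (trans (ℕ.*-comm u x) (sym 1+yp≡xu)) ⟩
    (1 + y * p) % p ≡⟨ [m+kn]%n≡m%n 1 y p ⟩
    1 % p           ≡⟨ m<n⇒m%n≡m 1<p ⟩
    1               ∎)
  -- Here u x ≡ -1 (mod p), so (p - 1) x is an inverse of u.
  ... | Bézout.-+ x y 1+xu≡yp = q * x , (begin
    (u * (q * x)) % p             ≡⟨ [m+kn]%n≡m%n (u * (q * x)) 1 p ⟨
    (u * (q * x) + 1 * p) % p     ≡⟨ cong (λ n → (u * (q * x) + 1 * n) % p) p≡1+q ⟩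
    (u * (q * x) + 1 * (1 + q)) % p ≡⟨ cong (_% p) (expand u q x) ⟩
    (1 + q * (1 + x * u)) % p     ≡⟨ cong (λ n → (1 + q * n) % p) 1+xu≡yp ⟩
    (1 + q * (y * p)) % p         ≡⟨ cong (λ n → (1 + n) % p) (ℕ.*-assoc q y p) ⟨
    (1 + q * y * p) % p           ≡⟨ [m+kn]%n≡m%n 1 (q * y) p ⟩
    1 % p                         ≡⟨ m<n⇒m%n≡m 1<p ⟩
    1                             ∎)
    where
    q : ℕ
    q = p ∸ 1
    p≡1+q : p ≡ 1 + q
    p≡1+q = sym (ℕ.m+[n∸m]≡n (ℕ.<⇒≤ 1<p))
    expand : ∀ u q x → u * (q * x) + 1 * (1 + q) ≡ 1 + q * (1 + x * u)
    expand = solve-∀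

  [m*[n%p]]%p≡[m*n]%p : ∀ m n → (m * (n % p)) % p ≡ (m * n) % p
  [m*[n%p]]%p≡[m*n]%p m n = begin
    (m * (n % p)) % p             ≡⟨ %-distribˡ-* m (n % p) p ⟩
    ((m % p) * (n % p % p)) % p   ≡⟨ cong (λ r → ((m % p) * r) % p) (m%n%n≡m%n n p) ⟩
    ((m % p) * (n % p)) % p       ≡⟨ %-distribˡ-* m n p ⟨
    (m * n) % p                   ∎

  %-inverse : ∀ {u v} → (u * v) % p ≡ 1 → ∀ {i} → i < p → (v * ((u * i) % p)) % p ≡ i
  %-inverse {u} {v} uv≡1 {i} i<p = begin
    (v * ((u * i) % p)) % p  ≡⟨ [m*[n%p]]%p≡[m*n]%p v (u * i) ⟩
    (v * (u * i)) % p        ≡⟨ cong (_% p) (rearrange v u i) ⟩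
    (i * (u * v)) % p        ≡⟨ [m*[n%p]]%p≡[m*n]%p i (u * v) ⟨
    (i * ((u * v) % p)) % p  ≡⟨ cong (λ r → (i * r) % p) uv≡1 ⟩
    (i * 1) % p              ≡⟨ cong (_% p) (ℕ.*-identityʳ i) ⟩
    i % p                    ≡⟨ m<n⇒m%n≡m i<p ⟩
    i                        ∎
    where
    rearrange : ∀ v u i → v * (u * i) ≡ i * (u * v)
    rearrange = solve-∀

  ^-monoʳ-∣ : ∀ {m n} → m ≤ n → p ^ m ∣ p ^ n
  ^-monoʳ-∣ {m} {n} m≤n = subst (p ^ m ∣_) p^m*p^[n∸m]≡p^n (m∣m*n (p ^ (n ∸ m)))
    where
    p^m*p^[n∸m]≡p^n : p ^ m * p ^ (n ∸ m) ≡ p ^ n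
    p^m*p^[n∸m]≡p^n = trans (sym (ℕ.^-distribˡ-+-* p m (n ∸ m))) (cong (p ^_) (ℕ.m+[n∸m]≡n m≤n))

  p^m∣a*x⇒p^m∣x : ∀ {a} → ¬ p ∣ a → ∀ m {x} → p ^ m ∣ a * x → p ^ m ∣ x
  p^m∣a*x⇒p^m∣x p∤a zero {x} _ = 1∣ x
  p^m∣a*x⇒p^m∣x {a} p∤a (suc m) {x} p^[1+m]∣ax with euclidsLemma a x p-prime (∣-trans (m∣m*n (p ^ m)) p^[1+m]∣ax)
  ... | inj₁ p∣a = contradiction p∣a p∤a
  ... | inj₂ (divides x′ refl) =
    subst (_∣ x′ * p) (ℕ.*-comm (p ^ m) p) (*-monoˡ-∣ p (p^m∣a*x⇒p^m∣x p∤a m (*-cancelʳ-∣ p p^m*p∣ax′*p)))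
    where
    p^m*p∣ax′*p : p ^ m * p ∣ a * x′ * p
    p^m*p∣ax′*p = subst₂ _∣_ (ℕ.*-comm p (p ^ m)) (sym (ℕ.*-assoc a x′ p)) p^[1+m]∣ax

  p∣x*x⇒p∣x : ∀ {x} → p ∣ x * x → p ∣ x
  p∣x*x⇒p∣x {x} p∣xx with euclidsLemma x x p-prime p∣xx
  ... | inj₁ p∣x = p∣x
  ... | inj₂ p∣x = p∣x

  p^m∣x*x⇒p^⌈m/2⌉∣x : ∀ m {x} → p ^ m ∣ x * x → p ^ ⌈ m /2⌉ ∣ x
  p^m∣x*x⇒p^⌈m/2⌉∣x zero {x} _ = 1∣ x
  p^m∣x*x⇒p^⌈m/2⌉∣x (suc zero) {x} p∣xx =
    subst (_∣ x) (sym (ℕ.*-identityʳ p)) (p∣x*x⇒p∣x (subst (_∣ x * x) (ℕ.*-identityʳ p) p∣xx))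
  p^m∣x*x⇒p^⌈m/2⌉∣x (suc (suc m)) {x} p²p^m∣xx with p∣x*x⇒p∣x {x} (∣-trans (m∣m*n (p ^ suc m)) p²p^m∣xx)
  ... | divides x′ refl =
    subst (_∣ x′ * p) (ℕ.*-comm (p ^ ⌈ m /2⌉) p) (*-monoˡ-∣ p (p^m∣x*x⇒p^⌈m/2⌉∣x m {x′} p^m∣x′x′))
    where
    instance
      p*p-nonZero : NonZero (p * p)
      p*p-nonZero = ℕ.m*n≢0 p p
    p^m∣x′x′ : p ^ m ∣ x′ * x′
    p^m∣x′x′ = *-cancelʳ-∣ (p * p) (subst₂ _∣_ (regroupˡ p (p ^ m)) (regroupʳ p x′) p²p^m∣xx)
      where
      regroupˡ : ∀ p a → p * (p * a) ≡ a * (p * p)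
      regroupˡ = solve-∀
      regroupʳ : ∀ p x → x * p * (x * p) ≡ x * x * (p * p)
      regroupʳ = solve-∀

  p^⌈m/2⌉∣x⇒p^m∣x*x : ∀ m {x} → p ^ ⌈ m /2⌉ ∣ x → p ^ m ∣ x * x
  p^⌈m/2⌉∣x⇒p^m∣x*x m {x} p^c∣x = ∣-trans (^-monoʳ-∣ m≤c+c)
    (subst (_∣ x * x) (sym (ℕ.^-distribˡ-+-* p c c)) (*-pres-∣ p^c∣x p^c∣x))
    where
    c : ℕ
    c = ⌈ m /2⌉
    m≤c+c : m ≤ c + c
    m≤c+c = subst (_≤ c + c) (ℕ.⌊n/2⌋+⌈n/2⌉≡n m) (ℕ.+-monoˡ-≤ c (ℕ.⌊n/2⌋≤⌈n/2⌉ m))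

module SumsProperties {r ℓ} (R : CommutativeRing r ℓ) (ζ : CommutativeRing.Carrier R) where
  open CommutativeRing R renaming (_+_ to _⊕_; _*_ to _⊗_)
  open Sums R ζ
  open import Data.Nat.Divisibility using (_∣_; _∣?_; ∣⇒≤; ∣m+n∣m⇒∣n; n∣m*n)
  open import Data.Fin using (Fin; toℕ; fromℕ<)
  import Data.Fin.Properties as Fin
  open import Data.Fin.Permutation using (Permutation; permutation; _⟨$⟩ʳ_)
  open import Algebra.Properties.CommutativeMonoid.Sum +-commutativeMonoid using (sum; sum-cong-≗; sum-permute)
  open import Algebra.Properties.CommutativeSemigroup +-commutativeSemigroup using (interchange; xy∙z≈xz∙y)
  open import Algebra.Properties.Group +-group using (quasigroup)
  open import Algebra.Properties.Quasigroup quasigroup using (x≈z//y)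
  open import Algebra.Properties.Semiring.Exp semiring using (^-congˡ; ^-homo-*; ^-assocʳ) renaming (_^_ to _^ᴿ_)
  open import Algebra.Properties.Monoid.Mult +-monoid using (×-homo-+) renaming (_×_ to _×ᴿ_)
  open import Algebra.Properties.Semiring.Mult semiring using (×1-homo-*)
  open import Relation.Binary.Reasoning.Setoid setoid

  infixl 5 _when_

  -- The summand of Sums.s is definitionally of this form.
  _when_ : {Q : Set} → Carrier → Dec Q → Carrier
  x when d = if does d then x else 0#

  when-yes : {Q : Set} (d : Dec Q) (x : Carrier) → Q → x when d ≈ x
  when-yes (yes _) x _ = refl
  when-yes (no ¬q) x q = contradiction q ¬q

  when-no : {Q : Set} (d : Dec Q) (x : Carrier) → ¬ Q → x when d ≈ 0#
  when-no (yes q) x ¬q = contradiction q ¬q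
  when-no (no _)  x _  = refl

  when-cong : {Q : Set} (d : Dec Q) {x y : Carrier} → x ≈ y → x when d ≈ y when d
  when-cong (yes _) x≈y = x≈y
  when-cong (no _)  x≈y = refl

  when-⇔ : {P Q : Set} (d : Dec P) (e : Dec Q) (x : Carrier) → (P → Q) → (Q → P) → x when d ≈ x when e
  when-⇔ (yes _) (yes _) x _   _   = refl
  when-⇔ (yes p) (no ¬q) x p→q _   = contradiction (p→q p) ¬q
  when-⇔ (no ¬p) (yes q) x _   q→p = contradiction (q→p q) ¬p
  when-⇔ (no _)  (no _)  x _   _   = refl

  pow≡^ : ∀ x n → pow x n ≡ x ^ᴿ n
  pow≡^ x zero    = ≡.refl
  pow≡^ x (suc n) = cong (x ⊗_) (pow≡^ x n)

  pow-homo-* : ∀ x m n → pow x (m + n) ≈ pow x m ⊗ pow x n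
  pow-homo-* x m n rewrite pow≡^ x (m + n) | pow≡^ x m | pow≡^ x n = ^-homo-* x m n

  pow-assocʳ : ∀ x m n → pow (pow x m) n ≈ pow x (m * n)
  pow-assocʳ x m n rewrite pow≡^ (pow x m) n | pow≡^ x m | pow≡^ x (m * n) = ^-assocʳ x m n

  pow-congˡ : ∀ n {x y} → x ≈ y → pow x n ≈ pow y n
  pow-congˡ n {x} {y} x≈y rewrite pow≡^ x n | pow≡^ y n = ^-congˡ n x≈y

  pow-1# : ∀ n → pow 1# n ≈ 1#
  pow-1# zero    = refl
  pow-1# (suc n) = trans (*-identityˡ _) (pow-1# n)

  module _ {x : Carrier} {M : ℕ} (x^M≈1 : pow x M ≈ 1#) where

    pow-multiple : ∀ q → pow x (q * M) ≈ 1#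
    pow-multiple q = begin
      pow x (q * M)   ≡⟨ cong (pow x) (ℕ.*-comm q M) ⟩
      pow x (M * q)   ≈⟨ pow-assocʳ x M q ⟨
      pow (pow x M) q ≈⟨ pow-congˡ q x^M≈1 ⟩
      pow 1# q        ≈⟨ pow-1# q ⟩
      1#              ∎

    pow-periodic : ∀ q r → pow x (q * M + r) ≈ pow x r
    pow-periodic q r = begin
      pow x (q * M + r)         ≈⟨ pow-homo-* x (q * M) r ⟩
      pow x (q * M) ⊗ pow x r   ≈⟨ *-congʳ (pow-multiple q) ⟩
      1# ⊗ pow x r              ≈⟨ *-identityˡ (pow x r) ⟩
      pow x r                   ∎

    pow-mod : .{{_ : NonZero M}} → ∀ n → pow x n ≈ pow x (n % M)
    pow-mod n = begin
      pow x n                    ≡⟨ cong (pow x) (≡.trans (m≡m%n+[m/n]*n n M) (ℕ.+-comm (n % M) _)) ⟩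
      pow x (n / M * M + n % M)  ≈⟨ pow-periodic (n / M) (n % M) ⟩
      pow x (n % M)              ∎

    pow-cong-mod : ∀ {r n} d → + r ≡ + n ℤ.+ d ℤ.* + M → pow x r ≈ pow x n
    pow-cong-mod {r} {n} (+ d) r≡n+dM = begin
      pow x r
        ≡⟨ cong (pow x) (ℤ.+-injective (≡.trans r≡n+dM (cong (λ z → + n ℤ.+ z) (≡.sym (ℤ.pos-* d M))))) ⟩
      pow x (n + d * M)
        ≡⟨ cong (pow x) (ℕ.+-comm n (d * M)) ⟩
      pow x (d * M + n)
        ≈⟨ pow-periodic d n ⟩
      pow x n           ∎
    pow-cong-mod {r} {n} ℤ.-[1+ d ] r≡n-[1+d]M = sym (begin
      pow x n                 ≡⟨ cong (pow x) (ℤ.+-injective n≡r+[1+d]M) ⟩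
      pow x (r + suc d * M)   ≡⟨ cong (pow x) (ℕ.+-comm r (suc d * M)) ⟩
      pow x (suc d * M + r)   ≈⟨ pow-periodic (suc d) r ⟩
      pow x r                 ∎)
      where
      cancel : ∀ n s M → n ≡ (n ℤ.+ ℤ.- s ℤ.* M) ℤ.+ s ℤ.* M
      cancel = ℤsolve-∀
      n≡r+[1+d]M : + n ≡ + (r + suc d * M)
      n≡r+[1+d]M = ≡.trans (cancel (+ n) (+ suc d) (+ M))
        (≡.trans (cong (λ z → z ℤ.+ + suc d ℤ.* + M) (≡.sym r≡n-[1+d]M)) (cong (λ z → + r ℤ.+ z) (≡.sym (ℤ.pos-* (suc d) M))))

  natR≡×1# : ∀ n → natR n ≡ n ×ᴿ 1#
  natR≡×1# zero    = ≡.refl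
  natR≡×1# (suc n) = cong (1# ⊕_) (natR≡×1# n)

  natR-homo-+ : ∀ m n → natR (m + n) ≈ natR m ⊕ natR n
  natR-homo-+ m n rewrite natR≡×1# (m + n) | natR≡×1# m | natR≡×1# n = ×-homo-+ 1# m n

  natR-homo-* : ∀ m n → natR (m * n) ≈ natR m ⊗ natR n
  natR-homo-* m n rewrite natR≡×1# (m * n) | natR≡×1# m | natR≡×1# n = ×1-homo-* m n

  natR-∸ : ∀ {m n} → n ≤ m → natR (m ∸ n) ≈ natR m - natR n
  natR-∸ {m} {n} n≤m = x≈z//y (natR (m ∸ n)) (natR n) (natR m) (begin
    natR (m ∸ n) ⊕ natR n ≈⟨ natR-homo-+ (m ∸ n) n ⟨
    natR (m ∸ n + n)      ≡⟨ cong natR (ℕ.m∸n+n≡m n≤m) ⟩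
    natR m                ∎)

  sumTo-cong : ∀ n {f g : ℕ → Carrier} → (∀ i → f i ≈ g i) → sumTo n f ≈ sumTo n g
  sumTo-cong zero    f≈g = refl
  sumTo-cong (suc n) f≈g = +-cong (sumTo-cong n f≈g) (f≈g n)

  sumTo-zero : ∀ n → sumTo n (λ _ → 0#) ≈ 0#
  sumTo-zero zero    = refl
  sumTo-zero (suc n) = trans (+-identityʳ _) (sumTo-zero n)

  sumTo-const : ∀ n x → sumTo n (λ _ → x) ≈ natR n ⊗ x
  sumTo-const zero    x = sym (zeroˡ x)
  sumTo-const (suc n) x = begin
    sumTo n (λ _ → x) ⊕ x     ≈⟨ +-cong (sumTo-const n x) (sym (*-identityˡ x)) ⟩
    natR n ⊗ x ⊕ 1# ⊗ x       ≈⟨ +-comm _ _ ⟩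
    1# ⊗ x ⊕ natR n ⊗ x       ≈⟨ distribʳ x 1# (natR n) ⟨
    (1# ⊕ natR n) ⊗ x         ∎

  sumTo-distrib-+ : ∀ n (f g : ℕ → Carrier) → sumTo n (λ i → f i ⊕ g i) ≈ sumTo n f ⊕ sumTo n g
  sumTo-distrib-+ zero    f g = sym (+-identityʳ 0#)
  sumTo-distrib-+ (suc n) f g = trans (+-congʳ (sumTo-distrib-+ n f g)) (interchange _ _ _ _)

  sumTo-distribˡ : ∀ n x (f : ℕ → Carrier) → sumTo n (λ i → x ⊗ f i) ≈ x ⊗ sumTo n f
  sumTo-distribˡ zero    x f = sym (zeroʳ x)
  sumTo-distribˡ (suc n) x f = trans (+-congʳ (sumTo-distribˡ n x f)) (sym (distribˡ x _ _))

  sumTo-distribʳ : ∀ n (f : ℕ → Carrier) x → sumTo n (λ i → f i ⊗ x) ≈ sumTo n f ⊗ x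
  sumTo-distribʳ zero    f x = sym (zeroˡ x)
  sumTo-distribʳ (suc n) f x = trans (+-congʳ (sumTo-distribʳ n f x)) (sym (distribʳ x _ _))

  sumTo-product : ∀ m n (f g : ℕ → Carrier) →
                  sumTo m (λ i → sumTo n (λ j → f i ⊗ g j)) ≈ sumTo m f ⊗ sumTo n g
  sumTo-product m n f g = begin
    sumTo m (λ i → sumTo n (λ j → f i ⊗ g j)) ≈⟨ sumTo-cong m (λ i → sumTo-distribˡ n (f i) g) ⟩
    sumTo m (λ i → f i ⊗ sumTo n g)           ≈⟨ sumTo-distribʳ m f (sumTo n g) ⟩
    sumTo m f ⊗ sumTo n g                     ∎

  sumTo-comm : ∀ m n (f : ℕ → ℕ → Carrier) →
               sumTo m (λ i → sumTo n (f i)) ≈ sumTo n (λ j → sumTo m (λ i → f i j))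
  sumTo-comm zero    n f = sym (sumTo-zero n)
  sumTo-comm (suc m) n f = trans (+-congʳ (sumTo-comm m n f)) (sym (sumTo-distrib-+ n _ (f m)))

  sumTo-++ : ∀ m n (f : ℕ → Carrier) → sumTo (m + n) f ≈ sumTo m f ⊕ sumTo n (λ i → f (m + i))
  sumTo-++ m zero    f rewrite ℕ.+-identityʳ m = sym (+-identityʳ _)
  sumTo-++ m (suc n) f rewrite ℕ.+-suc m n = trans (+-congʳ (sumTo-++ m n f)) (+-assoc _ _ _)

  sumTo-* : ∀ m n (f : ℕ → Carrier) → sumTo (m * n) f ≈ sumTo m (λ q → sumTo n (λ r → f (q * n + r)))
  sumTo-* zero    n f = refl
  sumTo-* (suc m) n f rewrite ℕ.+-comm n (m * n) = trans (sumTo-++ (m * n) n f) (+-congʳ (sumTo-* m n f))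

  sumTo-head : ∀ n (f : ℕ → Carrier) → (∀ i → i < n → f (suc i) ≈ 0#) → sumTo (suc n) f ≈ f 0
  sumTo-head zero    f _     = +-identityˡ (f 0)
  sumTo-head (suc n) f tail≈0 = begin
    sumTo (suc n) f ⊕ f (suc n)
      ≈⟨ +-cong (sumTo-head n f (λ i i<n → tail≈0 i (ℕ.m<n⇒m<1+n i<n))) (tail≈0 n (ℕ.n<1+n n)) ⟩
    f 0 ⊕ 0#
      ≈⟨ +-identityʳ (f 0) ⟩
    f 0                         ∎

  sumTo-pow-shift : ∀ x n → x ⊗ sumTo n (pow x) ⊕ 1# ≈ sumTo n (pow x) ⊕ pow x n
  sumTo-pow-shift x zero    = +-congʳ (zeroʳ x)
  sumTo-pow-shift x (suc n) = begin
    x ⊗ (sumTo n (pow x) ⊕ pow x n) ⊕ 1#        ≈⟨ +-congʳ (distribˡ x _ _) ⟩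
    x ⊗ sumTo n (pow x) ⊕ pow x (suc n) ⊕ 1#    ≈⟨ xy∙z≈xz∙y _ _ _ ⟩
    x ⊗ sumTo n (pow x) ⊕ 1# ⊕ pow x (suc n)    ≈⟨ +-congʳ (sumTo-pow-shift x n) ⟩
    sumTo n (pow x) ⊕ pow x n ⊕ pow x (suc n)   ∎

  sumTo≈sum : ∀ n (f : ℕ → Carrier) → sumTo n f ≈ sum {n} (λ i → f (toℕ i))
  sumTo≈sum zero    f = refl
  sumTo≈sum (suc n) f = trans (sumTo-++ 1 n f) (+-cong (+-identityˡ (f 0)) (sumTo≈sum n (λ i → f (suc i))))

  sumTo-permute : ∀ n (σ σ⁻¹ : ℕ → ℕ) → (∀ i → σ i < n) → (∀ i → σ⁻¹ i < n) →
                  (∀ {i} → i < n → σ (σ⁻¹ i) ≡ i) → (∀ {i} → i < n → σ⁻¹ (σ i) ≡ i) →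
                  ∀ (f : ℕ → Carrier) → sumTo n (λ i → f (σ i)) ≈ sumTo n f
  sumTo-permute n σ σ⁻¹ σ<n σ⁻¹<n σ∘σ⁻¹≗id σ⁻¹∘σ≗id f = begin
    sumTo n (λ i → f (σ i))        ≈⟨ sumTo≈sum n (λ i → f (σ i)) ⟩
    sum {n} (λ i → f (σ (toℕ i)))      ≡⟨ sum-cong-≗ {n} (λ i → cong f (≡.sym (Fin.toℕ-fromℕ< (σ<n (toℕ i))))) ⟩
    sum {n} (λ i → f (toℕ (π ⟨$⟩ʳ i))) ≈⟨ sum-permute (λ i → f (toℕ i)) π ⟨
    sum {n} (λ i → f (toℕ i))          ≈⟨ sumTo≈sum n f ⟨
    sumTo n f                      ∎
    where
    restrict : (g : ℕ → ℕ) → (∀ i → g i < n) → Fin n → Fin n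
    restrict g g<n i = fromℕ< (g<n (toℕ i))
    inverse : ∀ g h (g<n : ∀ i → g i < n) (h<n : ∀ i → h i < n) → (∀ {i} → i < n → g (h i) ≡ i) →
              ∀ i → restrict g g<n (restrict h h<n i) ≡ i
    inverse g h g<n h<n g∘h≗id i = Fin.toℕ-injective
      (≡.trans (Fin.toℕ-fromℕ< _) (≡.trans (cong g (Fin.toℕ-fromℕ< _)) (g∘h≗id (Fin.toℕ<n i))))
    π : Permutation n n
    π = permutation (restrict σ σ<n) (restrict σ⁻¹ σ⁻¹<n)
          (inverse σ σ⁻¹ σ<n σ⁻¹<n σ∘σ⁻¹≗id) (inverse σ⁻¹ σ σ⁻¹<n σ<n σ⁻¹∘σ≗id)

  sumTo-multiples : ∀ m n .{{_ : NonZero n}} (f : ℕ → Carrier) →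
                    sumTo (m * n) (λ x → f x when (n ∣? x)) ≈ sumTo m (λ q → f (q * n))
  sumTo-multiples m n@(suc n-1) f = trans (sumTo-* m n _) (sumTo-cong m block)
    where
    block : ∀ q → sumTo n (λ r → f (q * n + r) when (n ∣? q * n + r)) ≈ f (q * n)
    block q = begin
      sumTo n (λ r → f (q * n + r) when (n ∣? q * n + r))
        ≈⟨ sumTo-head n-1 _ (λ i i<n-1 → when-no (n ∣? _) _ (n∤qn+1+i i<n-1)) ⟩
      f (q * n + 0) when (n ∣? q * n + 0)
        ≈⟨ when-yes (n ∣? _) _ (subst (n ∣_) (≡.sym (ℕ.+-identityʳ (q * n))) (n∣m*n q)) ⟩
      f (q * n + 0)
        ≡⟨ cong f (ℕ.+-identityʳ (q * n)) ⟩
      f (q * n)                                           ∎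
      where
      n∤qn+1+i : ∀ {i} → i < n-1 → ¬ n ∣ q * n + suc i
      n∤qn+1+i i<n-1 n∣qn+1+i = ℕ.≤⇒≯ (∣⇒≤ (∣m+n∣m⇒∣n n∣qn+1+i (n∣m*n q))) (s≤s i<n-1)

  sumTo-count-multiples : ∀ m n .{{_ : NonZero n}} x → sumTo (m * n) (λ i → x when (n ∣? i)) ≈ natR m ⊗ x
  sumTo-count-multiples m n x = trans (sumTo-multiples m n (λ _ → x)) (sumTo-const m x)

module PrimePowerRoots {r ℓ} (R : CommutativeRing r ℓ) (ζ : CommutativeRing.Carrier R)
  {p κ : ℕ} (p-prime : Prime p) (root : Sums.IsRootΦ R ζ p (suc κ)) where
  open CommutativeRing R renaming (_+_ to _⊕_; _*_ to _⊗_)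
  open Sums R ζ
  open SumsProperties R ζ
  open PrimeDivisibility p-prime
  open import Data.Nat.Divisibility using (_∣_; _∣?_; divides; 1∣_; m∣m*n; *-monoˡ-∣)
  open import Relation.Binary.Reasoning.Setoid setoid

  k : ℕ
  k = suc κ

  N : ℕ
  N = p ^ k

  instance
    N-nonZero : NonZero N
    N-nonZero = ℕ.m^n≢0 p k

  -- Φ_{p^k}(x) = Φ_p(x^{p^{k-1}}), so y is a root of Φ_p = 1 + x + ⋯ + x^{p-1}.
  y : Carrier
  y = pow ζ (p ^ κ)

  Σy^i≈0 : sumTo p (pow y) ≈ 0#
  Σy^i≈0 = trans (sumTo-cong p y^i≈ζ^[i*p^κ]) root
    where
    y^i≈ζ^[i*p^κ] : ∀ i → pow y i ≈ pow ζ (i * p ^ κ)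
    y^i≈ζ^[i*p^κ] i = trans (pow-assocʳ ζ (p ^ κ) i) (reflexive (cong (pow ζ) (ℕ.*-comm (p ^ κ) i)))

  y^p≈1 : pow y p ≈ 1#
  y^p≈1 = begin
    pow y p                       ≈⟨ +-identityˡ (pow y p) ⟨
    0# ⊕ pow y p                  ≈⟨ +-congʳ Σy^i≈0 ⟨
    sumTo p (pow y) ⊕ pow y p     ≈⟨ sumTo-pow-shift y p ⟨
    y ⊗ sumTo p (pow y) ⊕ 1#      ≈⟨ +-congʳ (trans (*-congˡ Σy^i≈0) (zeroʳ y)) ⟩
    0# ⊕ 1#                       ≈⟨ +-identityˡ 1# ⟩
    1#                            ∎

  ζ^N≈1 : pow ζ N ≈ 1#
  ζ^N≈1 = begin
    pow ζ (p * p ^ κ) ≡⟨ cong (pow ζ) (ℕ.*-comm p (p ^ κ)) ⟩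
    pow ζ (p ^ κ * p) ≈⟨ pow-assocʳ ζ (p ^ κ) p ⟨
    pow y p           ≈⟨ y^p≈1 ⟩
    1#                ∎

  Σy^ui≈0 : ∀ {u} → ¬ p ∣ u → sumTo p (λ i → pow y (u * i)) ≈ 0#
  Σy^ui≈0 {u} p∤u with mod-inverse p∤u
  ... | v , uv%p≡1 = begin
    sumTo p (λ i → pow y (u * i))       ≈⟨ sumTo-cong p (λ i → pow-mod y^p≈1 (u * i)) ⟩
    sumTo p (λ i → pow y ((u * i) % p)) ≈⟨ sumTo-permute p (λ i → (u * i) % p) (λ i → (v * i) % p)
                                             (λ i → m%n<n (u * i) p) (λ i → m%n<n (v * i) p)
                                             (%-inverse {v} {u} vu%p≡1) (%-inverse {u} {v} uv%p≡1) (pow y) ⟩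
    sumTo p (pow y)                     ≈⟨ Σy^i≈0 ⟩
    0#                                  ∎
    where
    vu%p≡1 : (v * u) % p ≡ 1
    vu%p≡1 = ≡.trans (cong (_% p) (ℕ.*-comm v u)) uv%p≡1

  orthogonality-∣ : ∀ m v {n} → v + m ≡ k → p ^ m ∣ n →
                    sumTo (p ^ m) (λ t → pow ζ (n * p ^ v * t)) ≈ natR (p ^ m)
  orthogonality-∣ m v v+m≡k (divides d ≡.refl) = begin
    sumTo (p ^ m) (λ t → pow ζ (d * p ^ m * p ^ v * t))
      ≈⟨ sumTo-cong (p ^ m) (λ t → trans (reflexive (cong (pow ζ) (exponent t))) (pow-multiple ζ^N≈1 (d * t))) ⟩
    sumTo (p ^ m) (λ _ → 1#)
      ≈⟨ sumTo-const (p ^ m) 1# ⟩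
    natR (p ^ m) ⊗ 1#
      ≈⟨ *-identityʳ _ ⟩
    natR (p ^ m)                                       ∎
    where
    regroup : ∀ d M V t → d * M * V * t ≡ d * t * (V * M)
    regroup = solve-∀
    exponent : ∀ t → d * p ^ m * p ^ v * t ≡ d * t * N
    exponent t = ≡.trans (regroup d (p ^ m) (p ^ v) t)
      (cong (λ P → d * t * P) (≡.trans (≡.sym (ℕ.^-distribˡ-+-* p v m)) (cong (p ^_) v+m≡k)))

  character-split : ∀ m v n → v + suc m ≡ k →
    sumTo (p ^ suc m) (λ t → pow ζ (n * p ^ v * t)) ≈ sumTo p (λ q → pow y (n * q)) ⊗ sumTo (p ^ m) (λ r → pow ζ (n * p ^ v * r))
  character-split m v n v+1+m≡k = begin
    sumTo (p * p ^ m) (λ t → pow ζ (n * p ^ v * t))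
      ≈⟨ sumTo-* p (p ^ m) _ ⟩
    sumTo p (λ q → sumTo (p ^ m) (λ r → pow ζ (n * p ^ v * (q * p ^ m + r))))
      ≈⟨ sumTo-cong p (λ q → sumTo-cong (p ^ m) (split q)) ⟩
    sumTo p (λ q → sumTo (p ^ m) (λ r → pow y (n * q) ⊗ pow ζ (n * p ^ v * r)))
      ≈⟨ sumTo-product p (p ^ m) (λ q → pow y (n * q)) (λ r → pow ζ (n * p ^ v * r)) ⟩
    sumTo p (λ q → pow y (n * q)) ⊗ sumTo (p ^ m) (λ r → pow ζ (n * p ^ v * r))        ∎
    where
    regroup : ∀ n V q M r → n * V * (q * M + r) ≡ V * M * (n * q) + n * V * r
    regroup = solve-∀
    p^v*p^m≡p^κ : p ^ v * p ^ m ≡ p ^ κ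
    p^v*p^m≡p^κ = ≡.trans (≡.sym (ℕ.^-distribˡ-+-* p v m)) (cong (p ^_) (ℕ.suc-injective (≡.trans (≡.sym (ℕ.+-suc v m)) v+1+m≡k)))
    split : ∀ q r → pow ζ (n * p ^ v * (q * p ^ m + r)) ≈ pow y (n * q) ⊗ pow ζ (n * p ^ v * r)
    split q r = begin
      pow ζ (n * p ^ v * (q * p ^ m + r))
        ≡⟨ cong (pow ζ) (≡.trans (regroup n (p ^ v) q (p ^ m) r) (cong (λ P → P * (n * q) + n * p ^ v * r) p^v*p^m≡p^κ)) ⟩
      pow ζ (p ^ κ * (n * q) + n * p ^ v * r)
        ≈⟨ pow-homo-* ζ (p ^ κ * (n * q)) (n * p ^ v * r) ⟩
      pow ζ (p ^ κ * (n * q)) ⊗ pow ζ (n * p ^ v * r)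
        ≈⟨ *-congʳ (pow-assocʳ ζ (p ^ κ) (n * q)) ⟨
      pow y (n * q) ⊗ pow ζ (n * p ^ v * r)              ∎

  orthogonality-∤ : ∀ m v {n} → v + m ≡ k → ¬ p ^ m ∣ n →
                    sumTo (p ^ m) (λ t → pow ζ (n * p ^ v * t)) ≈ 0#
  orthogonality-∤ zero    v {n} _ p^0∤n = contradiction (1∣ n) p^0∤n
  orthogonality-∤ (suc m) v {n} v+1+m≡k p^[1+m]∤n = trans (character-split m v n v+1+m≡k) (vanish (p ∣? n))
    where
    vanish : Dec (p ∣ n) → sumTo p (λ q → pow y (n * q)) ⊗ sumTo (p ^ m) (λ r → pow ζ (n * p ^ v * r)) ≈ 0#
    vanish (no p∤n) = trans (*-congʳ (Σy^ui≈0 p∤n)) (zeroˡ _)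
    vanish (yes (divides n′ ≡.refl)) = trans (*-congˡ (trans (sumTo-cong (p ^ m) shift) inner≈0)) (zeroʳ _)
      where
      regroup : ∀ n′ p V r → n′ * p * V * r ≡ n′ * (p * V) * r
      regroup = solve-∀
      shift : ∀ r → pow ζ (n′ * p * p ^ v * r) ≈ pow ζ (n′ * p ^ suc v * r)
      shift r = reflexive (cong (pow ζ) (regroup n′ p (p ^ v) r))
      inner≈0 : sumTo (p ^ m) (λ r → pow ζ (n′ * p ^ suc v * r)) ≈ 0#
      inner≈0 = orthogonality-∤ m (suc v) {n′} (≡.trans (≡.sym (ℕ.+-suc v m)) v+1+m≡k)
        (λ p^m∣n′ → p^[1+m]∤n (subst (_∣ n′ * p) (ℕ.*-comm (p ^ m) p) (*-monoˡ-∣ p p^m∣n′)))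

  orthogonality : ∀ m v n → v + m ≡ k →
                  sumTo (p ^ m) (λ t → pow ζ (n * p ^ v * t)) ≈ natR (p ^ m) when (p ^ m ∣? n)
  orthogonality m v n v+m≡k with p ^ m ∣? n
  ... | yes p^m∣n = orthogonality-∣ m v v+m≡k p^m∣n
  ... | no p^m∤n  = orthogonality-∤ m v v+m≡k p^m∤n

  modN≡%ℕ : ∀ z M .{{_ : NonZero M}} → modN z M ≡ z ℤ.%ℕ M
  modN≡%ℕ z (suc M) = ≡.refl

  e≈pow : ∀ z n w → z ≡ + n ℤ.+ w ℤ.* + N → e N z ≈ pow ζ n
  e≈pow z n w z≡n+wN = begin
    e N z            ≡⟨ cong (pow ζ) (modN≡%ℕ z N) ⟩
    pow ζ (z ℤ.%ℕ N) ≈⟨ pow-cong-mod ζ^N≈1 (w ℤ.- q) r≡n+[w-q]N ⟩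
    pow ζ n          ∎
    where
    q = z ℤ./ℕ N
    add-sub : ∀ r q N → r ≡ r ℤ.+ q ℤ.* N ℤ.- q ℤ.* N
    add-sub = ℤsolve-∀
    collect : ∀ n w q N → n ℤ.+ w ℤ.* N ℤ.- q ℤ.* N ≡ n ℤ.+ (w ℤ.- q) ℤ.* N
    collect = ℤsolve-∀
    r≡n+[w-q]N : + (z ℤ.%ℕ N) ≡ + n ℤ.+ (w ℤ.- q) ℤ.* + N
    r≡n+[w-q]N = ≡.trans (add-sub (+ (z ℤ.%ℕ N)) q (+ N))
      (≡.trans (cong (ℤ._- q ℤ.* + N) (≡.trans (≡.sym (a≡a%ℕn+[a/ℕn]*n z N)) z≡n+wN))
               (collect (+ n) w q (+ N)))

  e-trivial : ∀ B u → k ≤ u → e N (B ℤ.* + (p ^ u)) ≈ 1#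
  e-trivial B u k≤u = e≈pow _ 0 (B ℤ.* + (p ^ (u ∸ k))) B*p^u≡0+[B*p^[u∸k]]*N
    where
    p^u≡p^[u∸k]*N : p ^ u ≡ p ^ (u ∸ k) * N
    p^u≡p^[u∸k]*N = ≡.trans (cong (p ^_) (≡.sym (ℕ.m∸n+n≡m k≤u))) (ℕ.^-distribˡ-+-* p (u ∸ k) k)
    B*p^u≡0+[B*p^[u∸k]]*N : B ℤ.* + (p ^ u) ≡ + 0 ℤ.+ B ℤ.* + (p ^ (u ∸ k)) ℤ.* + N
    B*p^u≡0+[B*p^[u∸k]]*N = ≡.trans (cong (B ℤ.*_) (≡.trans (cong +_ p^u≡p^[u∸k]*N) (ℤ.pos-* (p ^ (u ∸ k)) N)))
      (≡.trans (≡.sym (ℤ.*-assoc B _ _)) (≡.sym (ℤ.+-identityˡ _)))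

  G-trivial : ∀ B u → k ≤ u → G (B ℤ.* + (p ^ u)) N ≈ natR N
  G-trivial B u k≤u = begin
    sumTo N (λ j → e N (B ℤ.* + (p ^ u) ℤ.* + (j * j))) ≈⟨ sumTo-cong N term≈1 ⟩
    sumTo N (λ _ → 1#)                                  ≈⟨ sumTo-const N 1# ⟩
    natR N ⊗ 1#                                         ≈⟨ *-identityʳ (natR N) ⟩
    natR N                                              ∎
    where
    swap : ∀ B P X → B ℤ.* P ℤ.* X ≡ B ℤ.* X ℤ.* P
    swap = ℤsolve-∀
    term≈1 : ∀ j → e N (B ℤ.* + (p ^ u) ℤ.* + (j * j)) ≈ 1#
    term≈1 j = trans (reflexive (cong (e N) (swap B _ _))) (e-trivial (B ℤ.* + (j * j)) u k≤u)

  G-reduce : ∀ a t u → G (a ℤ.* + t ℤ.* + (p ^ u)) N ≈ sumTo N (λ x → pow ζ (a ℤ.%ℕ N * (x * x) * p ^ u * t))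
  G-reduce a t u = sumTo-cong N (λ x → e≈pow _ _ (a ℤ./ℕ N ℤ.* + t ℤ.* + (p ^ u) ℤ.* + (x * x)) (expand x))
    where
    a′ = a ℤ.%ℕ N
    distribute : ∀ A q N t P X → (A ℤ.+ q ℤ.* N) ℤ.* t ℤ.* P ℤ.* X ≡ A ℤ.* X ℤ.* P ℤ.* t ℤ.+ q ℤ.* t ℤ.* P ℤ.* X ℤ.* N
    distribute = ℤsolve-∀
    embed : ∀ a b c d → + (a * b * c * d) ≡ + a ℤ.* + b ℤ.* + c ℤ.* + d
    embed a b c d = ≡.trans (ℤ.pos-* (a * b * c) d) (cong (ℤ._* + d) (≡.trans (ℤ.pos-* (a * b) c) (cong (ℤ._* + c) (ℤ.pos-* a b))))
    expand : ∀ x → a ℤ.* + t ℤ.* + (p ^ u) ℤ.* + (x * x)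
                 ≡ + (a′ * (x * x) * p ^ u * t) ℤ.+ a ℤ./ℕ N ℤ.* + t ℤ.* + (p ^ u) ℤ.* + (x * x) ℤ.* + N
    expand x = ≡.trans (cong (λ A → A ℤ.* + t ℤ.* + (p ^ u) ℤ.* + (x * x)) (a≡a%ℕn+[a/ℕn]*n a N))
      (≡.trans (distribute (+ a′) (a ℤ./ℕ N) (+ N) (+ t) (+ (p ^ u)) (+ (x * x)))
               (cong (ℤ._+ a ℤ./ℕ N ℤ.* + t ℤ.* + (p ^ u) ℤ.* + (x * x) ℤ.* + N) (≡.sym (embed a′ (x * x) (p ^ u) t))))

  sumTo-coprime : ∀ m (f : ℕ → Carrier) →
    sumTo (m * p) (λ t → f t when coprime? t p) ⊕ sumTo m (λ q → f (q * p)) ≈ sumTo (m * p) f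
  sumTo-coprime m f = begin
    sumTo (m * p) (λ t → f t when coprime? t p) ⊕ sumTo m (λ q → f (q * p))
      ≈⟨ +-congˡ (sumTo-multiples m p f) ⟨
    sumTo (m * p) (λ t → f t when coprime? t p) ⊕ sumTo (m * p) (λ t → f t when (p ∣? t))
      ≈⟨ sumTo-distrib-+ (m * p) _ _ ⟨
    sumTo (m * p) (λ t → (f t when coprime? t p) ⊕ (f t when (p ∣? t)))
      ≈⟨ sumTo-cong (m * p) (λ t → partition (f t) (coprime? t p) (p ∣? t)) ⟩
    sumTo (m * p) f                                                                      ∎
    where
    partition : ∀ x {t} (d : Dec (Coprime t p)) (d′ : Dec (p ∣ t)) → (x when d) ⊕ (x when d′) ≈ x
    partition x (yes t⊥p) (yes p∣t) = contradiction p∣t (coprime⇒¬∣ t⊥p)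
    partition x (yes _)   (no _)    = +-identityʳ x
    partition x (no _)    (yes _)   = +-identityˡ x
    partition x (no ¬t⊥p) (no p∤t)  = ⊥-elim (¬t⊥p (¬∣⇒coprime p∤t))

  module TrivialFactors (a b₀ c₀ m₀ : ℤ) (b₁ c₁ m₁ τ : ℕ) (p∤a : ¬ p ∣ ∣ a ∣)
                  (k≤m₁+τ : k ≤ m₁ + τ) (k≤b₁+τ : k ≤ b₁ + τ) (k≤c₁+τ : k ≤ c₁ + τ) (τ<k : τ < k) where
    open import Data.Nat.Divisibility using (∣n⇒∣m*n)
    open import Data.Integer.Divisibility.Signed using (∣ᵤ⇒∣; ∣⇒∣ᵤ; ∣m∣n⇒∣m+n)
      renaming (_∣_ to _∣ℤ_; ∣n⇒∣m*n to ∣n⇒∣m*nℤ)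
    open import Algebra.Properties.Group +-group using (quasigroup)
    open import Algebra.Properties.Quasigroup quasigroup using (x≈z//y)

    a′ : ℕ
    a′ = a ℤ.%ℕ N

    p∤a′ : ¬ p ∣ a′
    p∤a′ p∣a′ = p∤a (∣⇒∣ᵤ (subst (+ p ∣ℤ_) (≡.sym (a≡a%ℕn+[a/ℕn]*n a N))
      (∣m∣n⇒∣m+n (∣ᵤ⇒∣ {+ p} {+ a′} p∣a′) (∣n⇒∣m*nℤ (a ℤ./ℕ N) (∣ᵤ⇒∣ {+ p} {+ N} (m∣m*n (p ^ κ)))))))

    C : Carrier
    C = natR N ⊗ natR N

    count-square-multiples : ∀ m → m ≤ k → ∀ w →
      sumTo N (λ x → w when (p ^ m ∣? a′ * (x * x))) ≈ natR (p ^ (k ∸ ⌈ m /2⌉)) ⊗ w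
    count-square-multiples m m≤k w = begin
      sumTo N (λ x → w when (p ^ m ∣? a′ * (x * x)))
        ≈⟨ sumTo-cong N (λ x → when-⇔ (p ^ m ∣? a′ * (x * x)) (p ^ c ∣? x) w (square⇒ x) (⇒square x)) ⟩
      sumTo N (λ x → w when (p ^ c ∣? x))
        ≡⟨ cong (λ n → sumTo n (λ x → w when (p ^ c ∣? x))) N≡p^[k∸c]*p^c ⟩
      sumTo (p ^ (k ∸ c) * p ^ c) (λ x → w when (p ^ c ∣? x))
        ≈⟨ sumTo-count-multiples (p ^ (k ∸ c)) (p ^ c) {{ℕ.m^n≢0 p c}} w ⟩
      natR (p ^ (k ∸ c)) ⊗ w                                    ∎
      where
      c : ℕ
      c = ⌈ m /2⌉
      square⇒ : ∀ x → p ^ m ∣ a′ * (x * x) → p ^ c ∣ x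
      square⇒ x p^m∣a′xx = p^m∣x*x⇒p^⌈m/2⌉∣x m (p^m∣a*x⇒p^m∣x p∤a′ m p^m∣a′xx)
      ⇒square : ∀ x → p ^ c ∣ x → p ^ m ∣ a′ * (x * x)
      ⇒square x p^c∣x = ∣n⇒∣m*n a′ (p^⌈m/2⌉∣x⇒p^m∣x*x m p^c∣x)
      N≡p^[k∸c]*p^c : N ≡ p ^ (k ∸ c) * p ^ c
      N≡p^[k∸c]*p^c = ≡.trans (cong (p ^_) (≡.sym (ℕ.m∸n+n≡m (ℕ.≤-trans (ℕ.⌈n/2⌉≤n m) m≤k))))
                              (ℕ.^-distribˡ-+-* p (k ∸ c) c)

    scale : ∀ m → m ≤ k → natR (p ^ (k ∸ ⌈ m /2⌉)) ⊗ natR (p ^ m) ⊗ C ≈ natR (p ^ (3 * k + ⌊ m /2⌋))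
    scale m m≤k = begin
      natR (p ^ (k ∸ ⌈ m /2⌉)) ⊗ natR (p ^ m) ⊗ (natR N ⊗ natR N)
        ≈⟨ *-cong (natR-homo-* (p ^ (k ∸ ⌈ m /2⌉)) (p ^ m)) (natR-homo-* N N) ⟨
      natR (p ^ (k ∸ ⌈ m /2⌉) * p ^ m) ⊗ natR (N * N)
        ≈⟨ natR-homo-* (p ^ (k ∸ ⌈ m /2⌉) * p ^ m) (N * N) ⟨
      natR (p ^ (k ∸ ⌈ m /2⌉) * p ^ m * (N * N))
        ≡⟨ cong natR (≡.sym (cong₂ _*_ (ℕ.^-distribˡ-+-* p (k ∸ ⌈ m /2⌉) m) (ℕ.^-distribˡ-+-* p k k))) ⟩
      natR (p ^ (k ∸ ⌈ m /2⌉ + m) * p ^ (k + k))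
        ≡⟨ cong natR (≡.sym (ℕ.^-distribˡ-+-* p (k ∸ ⌈ m /2⌉ + m) (k + k))) ⟩
      natR (p ^ (k ∸ ⌈ m /2⌉ + m + (k + k)))
        ≡⟨ cong (λ n → natR (p ^ (n + (k + k)))) (k∸⌈m/2⌉+m≡k+⌊m/2⌋ m≤k) ⟩
      natR (p ^ (k + ⌊ m /2⌋ + (k + k)))
        ≡⟨ cong (λ n → natR (p ^ n)) (collect k ⌊ m /2⌋) ⟩
      natR (p ^ (3 * k + ⌊ m /2⌋)) ∎
      where
      collect : ∀ k f → k + f + (k + k) ≡ 3 * k + f
      collect = solve-∀

    quadratic-sum : ∀ v m → v + m ≡ k →
      sumTo (p ^ m) (λ t → sumTo N (λ x → pow ζ (a′ * (x * x) * p ^ v * t)) ⊗ C) ≈ natR (p ^ (3 * k + ⌊ m /2⌋))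
    quadratic-sum v m v+m≡k = begin
      sumTo (p ^ m) (λ t → sumTo N (λ x → F x t) ⊗ C)
        ≈⟨ sumTo-distribʳ (p ^ m) _ C ⟩
      sumTo (p ^ m) (λ t → sumTo N (λ x → F x t)) ⊗ C
        ≈⟨ *-congʳ (sumTo-comm (p ^ m) N (λ t x → F x t)) ⟩
      sumTo N (λ x → sumTo (p ^ m) (F x)) ⊗ C
        ≈⟨ *-congʳ (sumTo-cong N (λ x → orthogonality m v (a′ * (x * x)) v+m≡k)) ⟩
      sumTo N (λ x → natR (p ^ m) when (p ^ m ∣? a′ * (x * x))) ⊗ C
        ≈⟨ *-congʳ (count-square-multiples m m≤k (natR (p ^ m))) ⟩
      natR (p ^ (k ∸ ⌈ m /2⌉)) ⊗ natR (p ^ m) ⊗ C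
        ≈⟨ scale m m≤k ⟩
      natR (p ^ (3 * k + ⌊ m /2⌋))                                  ∎
      where
      F : ℕ → ℕ → Carrier
      F x t = pow ζ (a′ * (x * x) * p ^ v * t)
      m≤k : m ≤ k
      m≤k = subst (m ≤_) v+m≡k (ℕ.m≤n+m m v)

    summand : ℕ → Carrier
    summand t = sumTo N (λ x → pow ζ (a′ * (x * x) * p ^ τ * t)) ⊗ C

    s-summand : ∀ t →
      e N (ℤ.- (m₀ ℤ.* + t ℤ.* + (p ^ (m₁ + τ)))) ⊗ G (a ℤ.* + t ℤ.* + (p ^ τ)) N
        ⊗ G (b₀ ℤ.* + t ℤ.* + (p ^ (b₁ + τ))) N ⊗ G (c₀ ℤ.* + t ℤ.* + (p ^ (c₁ + τ))) N
      ≈ summand t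
    s-summand t = begin
      e N (ℤ.- (m₀ ℤ.* + t ℤ.* + (p ^ (m₁ + τ)))) ⊗ G (a ℤ.* + t ℤ.* + (p ^ τ)) N
        ⊗ G (b₀ ℤ.* + t ℤ.* + (p ^ (b₁ + τ))) N ⊗ G (c₀ ℤ.* + t ℤ.* + (p ^ (c₁ + τ))) N
          ≈⟨ *-cong (*-cong (*-cong m-factor (G-reduce a t τ)) (G-trivial (b₀ ℤ.* + t) (b₁ + τ) k≤b₁+τ))
                    (G-trivial (c₀ ℤ.* + t) (c₁ + τ) k≤c₁+τ) ⟩
      1# ⊗ sumTo N (λ x → pow ζ (a′ * (x * x) * p ^ τ * t)) ⊗ natR N ⊗ natR N
          ≈⟨ *-congʳ (*-congʳ (*-identityˡ _)) ⟩
      sumTo N (λ x → pow ζ (a′ * (x * x) * p ^ τ * t)) ⊗ natR N ⊗ natR N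
          ≈⟨ *-assoc _ (natR N) (natR N) ⟩
      summand t ∎
      where
      m-factor : e N (ℤ.- (m₀ ℤ.* + t ℤ.* + (p ^ (m₁ + τ)))) ≈ 1#
      m-factor = trans (reflexive (cong (e N) (ℤ.neg-distribˡ-* (m₀ ℤ.* + t) (+ (p ^ (m₁ + τ))))))
                       (e-trivial (ℤ.- (m₀ ℤ.* + t)) (m₁ + τ) k≤m₁+τ)

    s-difference : ∀ i → k ∸ τ ≡ suc i →
      s p a b₀ c₀ m₀ b₁ c₁ m₁ k τ ⊕ natR (p ^ (3 * k + ⌊ i /2⌋)) ≈ natR (p ^ (3 * k + ⌊ suc i /2⌋))
    s-difference i k∸τ≡1+i = begin
      s p a b₀ c₀ m₀ b₁ c₁ m₁ k τ ⊕ natR (p ^ (3 * k + ⌊ i /2⌋))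
        ≈⟨ +-cong s≈Σcoprime (sym multiples-of-p) ⟩
      sumTo (p ^ i * p) (λ t → summand t when coprime? t p) ⊕ sumTo (p ^ i) (λ q → summand (q * p))
        ≈⟨ sumTo-coprime (p ^ i) summand ⟩
      sumTo (p ^ i * p) summand
        ≡⟨ cong (λ n → sumTo n summand) (ℕ.*-comm (p ^ i) p) ⟩
      sumTo (p ^ suc i) summand
        ≈⟨ quadratic-sum τ (suc i) τ+1+i≡k ⟩
      natR (p ^ (3 * k + ⌊ suc i /2⌋)) ∎
      where
      τ+1+i≡k : τ + suc i ≡ k
      τ+1+i≡k = ≡.trans (cong (λ j → τ + j) (≡.sym k∸τ≡1+i)) (ℕ.m+[n∸m]≡n (ℕ.<⇒≤ τ<k))
      p^[k∸τ]≡p^i*p : p ^ (k ∸ τ) ≡ p ^ i * p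
      p^[k∸τ]≡p^i*p = ≡.trans (cong (p ^_) k∸τ≡1+i) (ℕ.*-comm p (p ^ i))
      s≈Σcoprime : s p a b₀ c₀ m₀ b₁ c₁ m₁ k τ ≈ sumTo (p ^ i * p) (λ t → summand t when coprime? t p)
      s≈Σcoprime = trans (sumTo-cong (p ^ (k ∸ τ)) (λ t → when-cong (coprime? t p) (s-summand t)))
        (reflexive (cong (λ n → sumTo n (λ t → summand t when coprime? t p)) p^[k∸τ]≡p^i*p))
      regroup : ∀ A P p q → A * P * (q * p) ≡ A * (p * P) * q
      regroup = solve-∀
      multiples-of-p : sumTo (p ^ i) (λ q → summand (q * p)) ≈ natR (p ^ (3 * k + ⌊ i /2⌋))
      multiples-of-p = trans
        (sumTo-cong (p ^ i) (λ q → *-congʳ (sumTo-cong N (λ x → reflexive (cong (pow ζ) (regroup (a′ * (x * x)) (p ^ τ) p q))))))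
        (quadratic-sum (suc τ) i (≡.trans (≡.sym (ℕ.+-suc τ i)) τ+1+i≡k))

    s-even : ∀ h → k ∸ τ ≡ 2 * h →
      s p a b₀ c₀ m₀ b₁ c₁ m₁ k τ ≈ natR (p ^ (3 * k + h) ∸ p ^ (3 * k + h ∸ 1))
    s-even zero    k∸τ≡0     = contradiction k∸τ≡0 (ℕ.m>n⇒m∸n≢0 τ<k)
    s-even (suc h) k∸τ≡2+2h = begin
      s p a b₀ c₀ m₀ b₁ c₁ m₁ k τ
        ≈⟨ x≈z//y _ _ _ (s-difference (suc (2 * h)) (≡.trans k∸τ≡2+2h (ℕ.*-suc 2 h))) ⟩
      natR (p ^ (3 * k + suc ⌊ 2 * h /2⌋)) - natR (p ^ (3 * k + ⌈ 2 * h /2⌉))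
        ≡⟨ cong₂ (λ f f′ → natR (p ^ (3 * k + suc f)) - natR (p ^ (3 * k + f′))) (⌊2*n/2⌋≡n h) (⌈2*n/2⌉≡n h) ⟩
      natR (p ^ (3 * k + suc h)) - natR (p ^ (3 * k + h))
        ≈⟨ natR-∸ (ℕ.^-monoʳ-≤ p (ℕ.+-monoʳ-≤ (3 * k) (ℕ.n≤1+n h))) ⟨
      natR (p ^ (3 * k + suc h) ∸ p ^ (3 * k + h))
        ≡⟨ cong (λ n → natR (p ^ (3 * k + suc h) ∸ p ^ (n ∸ 1))) (ℕ.+-suc (3 * k) h) ⟨
      natR (p ^ (3 * k + suc h) ∸ p ^ (3 * k + suc h ∸ 1)) ∎

    s-odd : ∀ h → k ∸ τ ≡ 1 + 2 * h → s p a b₀ c₀ m₀ b₁ c₁ m₁ k τ ≈ 0#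
    s-odd h k∸τ≡1+2h = begin
      s p a b₀ c₀ m₀ b₁ c₁ m₁ k τ
        ≈⟨ x≈z//y _ _ _ (s-difference (2 * h) k∸τ≡1+2h) ⟩
      natR (p ^ (3 * k + ⌈ 2 * h /2⌉)) - natR (p ^ (3 * k + ⌊ 2 * h /2⌋))
        ≡⟨ cong₂ (λ f f′ → natR (p ^ (3 * k + f)) - natR (p ^ (3 * k + f′))) (⌈2*n/2⌉≡n h) (⌊2*n/2⌋≡n h) ⟩
      natR (p ^ (3 * k + h)) - natR (p ^ (3 * k + h))
        ≈⟨ -‿inverseʳ _ ⟩
      0# ∎

open import Data.Integer.Divisibility using (_∣_)

lemma4p2 : ∀ {c ℓ : Level} (R : CommutativeRing c ℓ) (ζ : CommutativeRing.Carrier R)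
  (p : ℕ) (a b₀ c₀ m₀ : ℤ) (b₁ c₁ m₁ k τ : ℕ) →
  Prime p → p ≢ 2 →
  ¬ (ℤ.+ p ∣ a) →
  b₁ ≤ c₁ →
  Coprime ∣ b₀ ∣ p → Coprime ∣ c₀ ∣ p → Coprime ∣ m₀ ∣ p →
  m₀ ≢ ℤ.+ 0 →
  m₁ < k →
  Sums.IsRootΦ R ζ p k →
  k ∸ (m₁ ⊓ b₁) ≤ τ → τ ≤ k ∸ 1 →
  (∀ h → k ∸ τ ≡ 2 * h →
    CommutativeRing._≈_ R (Sums.s R ζ p a b₀ c₀ m₀ b₁ c₁ m₁ k τ)
      (Sums.natR R ζ (p ^ (3 * k + h) ∸ p ^ (3 * k + h ∸ 1))))
  Data.Product.× (∀ h → k ∸ τ ≡ 1 + 2 * h →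
    CommutativeRing._≈_ R (Sums.s R ζ p a b₀ c₀ m₀ b₁ c₁ m₁ k τ)
      (CommutativeRing.0# R))
lemma4p2 R ζ p a b₀ c₀ m₀ b₁ c₁ m₁ zero    τ _ _ _ _ _ _ _ _ () _ _ _
lemma4p2 R ζ p a b₀ c₀ m₀ b₁ c₁ m₁ (suc κ) τ p-prime _ p∤a b₁≤c₁ _ _ _ _ _ root k∸⊓≤τ τ≤κ =
  s-even , s-odd
  where
  k≤w+τ : ∀ {w} → m₁ ⊓ b₁ ≤ w → suc κ ≤ w + τ
  k≤w+τ ⊓≤w = ℕ.≤-trans (ℕ.m≤n+m∸n (suc κ) (m₁ ⊓ b₁)) (ℕ.+-mono-≤ ⊓≤w k∸⊓≤τ)
  open PrimePowerRoots R ζ {κ = κ} p-prime root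
  open TrivialFactors a b₀ c₀ m₀ b₁ c₁ m₁ τ p∤a (k≤w+τ (ℕ.m⊓n≤m m₁ b₁)) (k≤w+τ (ℕ.m⊓n≤n m₁ b₁))
                (k≤w+τ (ℕ.≤-trans (ℕ.m⊓n≤n m₁ b₁) b₁≤c₁)) (s≤s τ≤κ)
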